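{- Let $n\ge 2$ and let $\mathcal{A}$ be the auxiliary cycle of order $n$. Then for each $v\in V(\mathcal{A})$ there exists exactly one temporal $v,v$-path in $\mathcal{A}$. Moreover, for any $i\neq k$ with $n-1\notin\{i,k\}$, the temporal $v_i,v_i$-path and the temporal $v_k,v_k$-path share no temporal arc, i.e., there is no pair $(e,t)$ with $e$ an arc and $t\in\lambda(e)$ such that both paths traverse $e$ at time $t$.
   Context: A temporal digraph is a pair $(D,\lambda)$ with $D$ a digraph and $\lambda$ assigning to each arc a finite set of integer times. Non-strict model: a temporal walk is a sequence $(v_1,t_1,v_2,\dots,v_q,t_q,v_{q+1})$ with $q\ge1$, $v_iv_{i+1}\in A(D)$, $t_i\in\lambda(v_iv_{i+1})$, and $t_1\le\dots\le t_q$; a temporal $v,v$-path is such a walk with $v_1=v_{q+1}=v$ and $v_1,\dots,v_q$ distinct. The auxiliary cycle of order $n$ is the temporal digraph with vertex set $\{v_0,\dots,v_{n-1}\}$ and arcs $e_0=v_{n-1}v_0$ and $e_i=v_{i-1}v_i$ for $1\le i\le n-1$, with $\lambda(e_0)=\{0,n,2n,\dots,(n-1)n\}$ and $\lambda(e_i)=\{n-i,2n-i,3n-i,\dots,(n-1)n-i\}$ for $1\le i\le n-1$. -}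

module Defs where

open import Data.Nat using (ℕ; zero; suc; _≟_)
open import Data.Fin using (Fin; toℕ; inject₁; fromℕ)
open import Data.Fin.Base using () renaming (_≤_ to _≤ᶠ_)
open import Data.Integer using (ℤ; +_; _-_; _≤_)
open import Data.List using (List; map; upTo; drop)
open import Data.List.Membership.Propositional using (_∈_)
open import Data.Vec using (Vec; lookup)
open import Data.Product using (Σ; _×_; ∃; ∃-syntax)
open import Data.Sum using (_⊎_)
open import Function.Definitions using (Injective)
open import Relation.Binary.PropositionalEquality using (_≡_)
open import Relation.Nullary using (yes; no)

-- A temporal digraph on the vertex set Fin n: an arc relation and, for
-- each ordered pair, a finite set (list) of integer times; λ is only
-- meaningful on arcs (the walk conditions require both).
record TemporalDigraph (n : ℕ) : Set₁ where
  field
    Arc   : Fin n → Fin n → Set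
    times : Fin n → Fin n → List ℤ

-- A sequence (v_1,t_1,v_2,...,v_q,t_q,v_{q+1}):
-- q, vertices v_1..v_{q+1} (indices 0..q), times t_1..t_q (indices 0..q-1).
record Seq (n : ℕ) : Set where
  constructor mkSeq
  field
    len   : ℕ
    verts : Vec (Fin n) (suc len)
    tms   : Vec ℤ len
open Seq public

src : ∀ {n} (W : Seq n) → Fin (len W) → Fin n
src W i = lookup (verts W) (inject₁ i)

tgt : ∀ {n} (W : Seq n) → Fin (len W) → Fin n
tgt W i = lookup (verts W) (Data.Fin.suc i)

record IsTemporalWalk {n : ℕ} (D : TemporalDigraph n) (W : Seq n) : Set where
  open TemporalDigraph D
  field
    nonempty : 1 Data.Nat.≤ len W
    arcs     : ∀ i → Arc (src W i) (tgt W i)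
    inLabel  : ∀ i → lookup (tms W) i ∈ times (src W i) (tgt W i)
    nondecr  : ∀ i j → i ≤ᶠ j → lookup (tms W) i ≤ lookup (tms W) j

record IsTemporalVVPath {n : ℕ} (D : TemporalDigraph n) (v : Fin n) (W : Seq n) : Set where
  field
    walk     : IsTemporalWalk D W
    starts   : lookup (verts W) (Data.Fin.zero) ≡ v
    ends     : lookup (verts W) (fromℕ (len W)) ≡ v
    distinct : Injective _≡_ _≡_ (src W)

-- The auxiliary cycle of order n. Arc e_i has head v_i:
-- e_0 = v_{n-1} v_0, e_i = v_{i-1} v_i (1 ≤ i ≤ n-1).
auxArc : (n : ℕ) → Fin n → Fin n → Set
auxArc n u v = (suc (toℕ u) ≡ toℕ v) ⊎ ((suc (toℕ u) ≡ n) × (toℕ v ≡ 0))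

-- λ(e_0) = {0, n, ..., (n-1)n};  λ(e_i) = {n-i, 2n-i, ..., (n-1)n-i}.
-- Labels are indexed by the head of the arc (and ignored for non-arcs).
auxLabel : (n : ℕ) → Fin n → List ℤ
auxLabel n v with toℕ v
... | zero  = map (λ j → + (j Data.Nat.* n)) (upTo n)
... | suc i = map (λ j → + (j Data.Nat.* n) - + (suc i)) (drop 1 (upTo n))

auxiliaryCycle : (n : ℕ) → TemporalDigraph n
auxiliaryCycle n = record
  { Arc   = auxArc n
  ; times = λ _ v → auxLabel n v }

ShareTemporalArc : ∀ {n} → Seq n → Seq n → Set
ShareTemporalArc W W' =
  ∃[ a ] ∃[ b ] (src W a ≡ src W' b × tgt W a ≡ tgt W' b
                 × lookup (tms W) a ≡ lookup (tms W') b)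

module Submission where

-- The underlying digraph is the directed n-cycle v_i → v_(i+1 mod n), so a temporal
-- v_i,v_i-path goes exactly once around it, its step j entering v_(i+j+1 mod n).
-- Every label of that arc is c·n − (i+j+1) for a "round" 1 ≤ c ≤ n, and since the
-- times do not decrease while the heads advance by one, the rounds increase strictly
-- along the n steps; hence round j is j+1 and the j-th time is (j+1)(n−1) − i.
-- Such times of two paths coincide only if their start indices agree modulo n − 1,
-- i.e. (for indices below n − 1) only if the paths are the same.

open import Data.Fin using (Fin; zero; suc; toℕ; fromℕ; fromℕ<; inject₁)
open import Data.Fin.Properties
  using (toℕ<n; toℕ-injective; toℕ-fromℕ; toℕ-fromℕ<; toℕ-inject₁; injective⇒≤)
open import Data.Integer using (ℤ; +_; -_; +≤+)
  renaming (_+_ to _+ℤ_; _-_ to _-ℤ_; _≤_ to _≤ℤ_)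
import Data.Integer.Properties as ℤ
open import Data.Integer.Tactic.RingSolver using (solve-∀)
open import Data.List using (map; upTo)
open import Data.List.Membership.Propositional using (_∈_)
open import Data.List.Membership.Propositional.Properties
  using (∈-map⁺; ∈-map⁻; ∈-applyUpTo⁺; ∈-applyUpTo⁻; ∈-upTo⁺; ∈-upTo⁻)
open import Data.Nat using (ℕ; zero; suc; _+_; _*_; _∸_; _≤_; _<_; _<?_; z≤n; s≤s; s≤s⁻¹; NonZero)
open import Data.Nat.DivMod
  using (_%_; _mod_; m<n⇒m%n≡m; m%n<n; n%n≡0; [m+n]%n≡m%n; [m+kn]%n≡m%n; %-distribˡ-+; m%n%n≡m%n)
open import Data.Nat.Properties
open import Data.Product using (_×_; _,_; proj₁; proj₂; ∃-syntax)
open import Data.Sum using (_⊎_; inj₁; inj₂)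
open import Data.Vec using (Vec; _∷_; lookup; tabulate)
open import Data.Vec.Properties using (lookup∘tabulate; tabulate∘lookup; tabulate-cong)
open import Function using (_∘_)
open import Relation.Binary.Definitions using (tri<; tri≈; tri>)
open import Relation.Binary.PropositionalEquality
  using (_≡_; _≢_; refl; sym; trans; cong; cong₂; subst; subst₂; module ≡-Reasoning)
open import Relation.Nullary using (¬_; yes; no; contradiction)

open import Defs

private
  a-b≡[c+a]-[c+b] : ∀ (a b c : ℤ) → a -ℤ b ≡ (c +ℤ a) -ℤ (c +ℤ b)
  a-b≡[c+a]-[c+b] = solve-∀

  [a-b]+[b+d]≡a+d : ∀ (a b d : ℤ) → (a -ℤ b) +ℤ (b +ℤ d) ≡ a +ℤ d
  [a-b]+[b+d]≡a+d = solve-∀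

  [c-d]+[b+d]≡c+b : ∀ (c d b : ℤ) → (c -ℤ d) +ℤ (b +ℤ d) ≡ c +ℤ b
  [c-d]+[b+d]≡c+b = solve-∀

a-b≤c-d⇒a+d≤c+b : ∀ a b c d → + a -ℤ + b ≤ℤ + c -ℤ + d → a + d ≤ c + b
a-b≤c-d⇒a+d≤c+b a b c d a-b≤c-d = ℤ.drop‿+≤+
  (subst₂ _≤ℤ_ ([a-b]+[b+d]≡a+d (+ a) (+ b) (+ d)) ([c-d]+[b+d]≡c+b (+ c) (+ d) (+ b))
    (ℤ.+-monoˡ-≤ (+ (b + d)) a-b≤c-d))

a-b≡c-d⇒a+d≡c+b : ∀ a b c d → + a -ℤ + b ≡ + c -ℤ + d → a + d ≡ c + b
a-b≡c-d⇒a+d≡c+b a b c d a-b≡c-d = ℤ.+-injective (begin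
  + (a + d)                  ≡⟨ [a-b]+[b+d]≡a+d (+ a) (+ b) (+ d) ⟨
  (+ a -ℤ + b) +ℤ + (b + d)  ≡⟨ cong (_+ℤ + (b + d)) a-b≡c-d ⟩
  (+ c -ℤ + d) +ℤ + (b + d)  ≡⟨ [c-d]+[b+d]≡c+b (+ c) (+ d) (+ b) ⟩
  + (c + b)                  ∎)
  where open ≡-Reasoning

a*d+r≡b*d+s⇒r≡s : ∀ {a b r s} d → r < d → s < d → a * d + r ≡ b * d + s → r ≡ s
a*d+r≡b*d+s⇒r≡s {a} {b} {r} {s} d@(suc _) r<d s<d eq = begin
  r                ≡⟨ m<n⇒m%n≡m r<d ⟨
  r % d            ≡⟨ [m+kn]%n≡m%n r a d ⟨
  (r + a * d) % d  ≡⟨ cong (_% d) (trans (+-comm r (a * d)) (trans eq (+-comm (b * d) s))) ⟩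
  (s + b * d) % d  ≡⟨ [m+kn]%n≡m%n s b d ⟩
  s % d            ≡⟨ m<n⇒m%n≡m s<d ⟩
  s                ∎
  where open ≡-Reasoning

lookup≗⇒≡tabulate : ∀ {A : Set} {k} {xs : Vec A k} {f : Fin k → A} →
  (∀ j → lookup xs j ≡ f j) → xs ≡ tabulate f
lookup≗⇒≡tabulate {xs = xs} xs≗f = trans (sym (tabulate∘lookup xs)) (tabulate-cong xs≗f)

strictlyIncreasing⇒≡suc : ∀ {n} (c : Fin n → ℕ) →
  (∀ {j k} → toℕ j < toℕ k → c j < c k) → (∀ j → 0 < c j) → (∀ j → c j ≤ n) →
  ∀ j → c j ≡ suc (toℕ j)
strictlyIncreasing⇒≡suc {n} c increasing positive bounded j = ≤-antisym c≤1+j (below (toℕ j) j refl)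
  where

  below : ∀ k (j : Fin n) → toℕ j ≡ k → suc k ≤ c j
  below zero    j _      = positive j
  below (suc k) j j≡1+k  = ≤-<-trans (below k j′ (toℕ-fromℕ< k<n)) (increasing j′<j)
    where
    k<n : k < n
    k<n = <-trans (n<1+n k) (subst (_< n) j≡1+k (toℕ<n j))
    j′ = fromℕ< k<n
    j′<j : toℕ j′ < toℕ j
    j′<j = subst₂ _<_ (sym (toℕ-fromℕ< k<n)) (sym j≡1+k) (n<1+n k)

  above : ∀ d (j : Fin n) → suc (toℕ j) + d ≡ n → c j + d ≤ n
  above zero    j _        = subst (_≤ n) (sym (+-identityʳ (c j))) (bounded j)
  above (suc d) j j+1+d≡n  =
    subst (_≤ n) (sym (+-suc (c j) d))
      (≤-trans (+-monoˡ-≤ d (increasing j<j′))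
        (above d j′ (trans (cong (λ i → suc i + d) (toℕ-fromℕ< 1+j<n)) (sym j+1+d≡n′))))
    where
    j+1+d≡n′ : n ≡ suc (suc (toℕ j)) + d
    j+1+d≡n′ = trans (sym j+1+d≡n) (+-suc (suc (toℕ j)) d)
    1+j<n : suc (toℕ j) < n
    1+j<n = subst (suc (toℕ j) <_) j+1+d≡n (m<m+n (suc (toℕ j)) (s≤s z≤n))
    j′ = fromℕ< 1+j<n
    j<j′ : toℕ j < toℕ j′
    j<j′ = subst (toℕ j <_) (sym (toℕ-fromℕ< 1+j<n)) (n<1+n (toℕ j))

  rest = n ∸ suc (toℕ j)

  j+rest≡n : suc (toℕ j) + rest ≡ n
  j+rest≡n = m+[n∸m]≡n (toℕ<n j)

  c≤1+j : c j ≤ suc (toℕ j)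
  c≤1+j = +-cancelʳ-≤ rest (c j) (suc (toℕ j))
    (subst (c j + rest ≤_) (sym j+rest≡n) (above rest j j+rest≡n))

-- c·n − s is the round-c label of an arc with head v_(s mod n); s is the head
-- counted along the walk, without reduction modulo n.
roundTime : ℕ → ℕ → ℕ → ℤ
roundTime n c s = + (c * n) -ℤ + s

roundTime-suc : ∀ n c s → roundTime n c s ≡ roundTime n (suc c) (n + s)
roundTime-suc n c s = a-b≡[c+a]-[c+b] (+ (c * n)) (+ s) (+ n)

roundTime-≤⇒< : ∀ n {c c′ s s′} → roundTime n c s ≤ℤ roundTime n c′ s′ → s < s′ → c < c′
roundTime-≤⇒< n {c} {c′} {s} {s′} c-s≤c′-s′ s<s′ = *-cancelʳ-< n c c′ (+-cancelʳ-< s (c * n) (c′ * n)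
  (<-≤-trans (+-monoʳ-< (c * n) s<s′) (a-b≤c-d⇒a+d≤c+b (c * n) s (c′ * n) s′ c-s≤c′-s′)))

∈-auxLabel⁺ : ∀ {n k} (h : Fin n) → k < n → toℕ h ≡ 0 ⊎ 0 < k → roundTime n k (toℕ h) ∈ auxLabel n h
∈-auxLabel⁺ {n@(suc _)} {k} h k<n h≡0⊎0<k with toℕ h
... | zero = subst (_∈ map (λ j → + (j * n)) (upTo n)) (cong +_ (sym (+-identityʳ (k * n))))
               (∈-map⁺ (λ j → + (j * n)) (∈-upTo⁺ k<n))
... | suc i with h≡0⊎0<k
...   | inj₂ (s≤s z≤n) = ∈-map⁺ (λ j → roundTime n j (suc i)) (∈-applyUpTo⁺ suc (s≤s⁻¹ k<n))

∈-auxLabel⁻ : ∀ {n t} (h : Fin n) → t ∈ auxLabel n h →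
  ∃[ k ] k < n × (toℕ h ≡ 0 ⊎ 0 < k) × t ≡ roundTime n k (toℕ h)
∈-auxLabel⁻ {n@(suc _)} h t∈ with toℕ h
... | zero with ∈-map⁻ (λ j → + (j * n)) t∈
...   | k , k∈ , t≡ = k , ∈-upTo⁻ {n} k∈ , inj₁ refl , trans t≡ (cong +_ (sym (+-identityʳ (k * n))))
∈-auxLabel⁻ {n@(suc _)} h t∈ | suc i with ∈-map⁻ (λ j → roundTime n j (suc i)) t∈
...   | k , k∈ , refl with ∈-applyUpTo⁻ suc k∈
...     | k′ , k′<n-1 , refl = suc k′ , s≤s k′<n-1 , inj₂ (s≤s z≤n) , refl

module _ {n} .{{_ : NonZero n}} where

  m<n+n⇒m%n≡m⊎n+m%n≡m : ∀ {s} → s < n + n → s % n ≡ s ⊎ n + s % n ≡ s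
  m<n+n⇒m%n≡m⊎n+m%n≡m {s} s<n+n with s <? n
  ... | yes s<n = inj₁ (m<n⇒m%n≡m s<n)
  ... | no  s≮n = inj₂ (begin
    n + s % n              ≡⟨ cong (λ x → n + x % n) (m∸n+n≡m n≤s) ⟨
    n + (s ∸ n + n) % n    ≡⟨ cong (λ x → n + x) ([m+n]%n≡m%n (s ∸ n) n) ⟩
    n + (s ∸ n) % n        ≡⟨ cong (λ x → n + x) (m<n⇒m%n≡m (m<n+o⇒m∸n<o s n s<n+n)) ⟩
    n + (s ∸ n)            ≡⟨ m+[n∸m]≡n n≤s ⟩
    s                      ∎)
    where
    open ≡-Reasoning
    n≤s = ≮⇒≥ s≮n

  [k+m%n]%n≡[k+m]%n : ∀ k a → (k + a % n) % n ≡ (k + a) % n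
  [k+m%n]%n≡[k+m]%n k a = begin
    (k + a % n) % n            ≡⟨ %-distribˡ-+ k (a % n) n ⟩
    (k % n + a % n % n) % n    ≡⟨ cong (λ x → (k % n + x) % n) (m%n%n≡m%n a n) ⟩
    (k % n + a % n) % n        ≡⟨ %-distribˡ-+ k a n ⟨
    (k + a) % n                ∎
    where open ≡-Reasoning

  [q+i]%n≡i⇒q≡n : ∀ {q i} → i < n → 0 < q → q ≤ n → (q + i) % n ≡ i → q ≡ n
  [q+i]%n≡i⇒q≡n {q} {i} i<n 0<q q≤n [q+i]%n≡i with m<n+n⇒m%n≡m⊎n+m%n≡m (+-mono-≤-< q≤n i<n)
  ... | inj₁ [q+i]%n≡q+i = contradiction (+-cancelʳ-≡ i q 0 (trans (sym [q+i]%n≡q+i) [q+i]%n≡i)) (>⇒≢ 0<q)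
  ... | inj₂ n+[q+i]%n≡q+i = +-cancelʳ-≡ i q n (trans (sym n+[q+i]%n≡q+i) (cong (λ x → n + x) [q+i]%n≡i))

  <⇒+-%-≢ : ∀ i {j k} → j < k → k < n → (j + i) % n ≢ (k + i) % n
  <⇒+-%-≢ i {j} {k} j<k k<n [j+i]%n≡[k+i]%n = <⇒≢ k∸j<n
    ([q+i]%n≡i⇒q≡n (m%n<n (j + i) n) (m<n⇒0<n∸m j<k) (<⇒≤ k∸j<n) (begin
      (k ∸ j + (j + i) % n) % n  ≡⟨ [k+m%n]%n≡[k+m]%n (k ∸ j) (j + i) ⟩
      (k ∸ j + (j + i)) % n      ≡⟨ cong (_% n) (+-assoc (k ∸ j) j i) ⟨
      (k ∸ j + j + i) % n        ≡⟨ cong (λ x → (x + i) % n) (m∸n+n≡m (<⇒≤ j<k)) ⟩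
      (k + i) % n                ≡⟨ [j+i]%n≡[k+i]%n ⟨
      (j + i) % n                ∎))
    where
    open ≡-Reasoning
    k∸j<n = ≤-<-trans (m∸n≤m k j) k<n

  +-%-cancelʳ : ∀ i {j k} → j < n → k < n → (j + i) % n ≡ (k + i) % n → j ≡ k
  +-%-cancelʳ i {j} {k} j<n k<n [j+i]%n≡[k+i]%n with <-cmp j k
  ... | tri< j<k _ _ = contradiction [j+i]%n≡[k+i]%n (<⇒+-%-≢ i j<k k<n)
  ... | tri≈ _ j≡k _ = j≡k
  ... | tri> _ _ k<j = contradiction (sym [j+i]%n≡[k+i]%n) (<⇒+-%-≢ i k<j j<n)

  roundTime⇒∈-auxLabel : ∀ {c s} (h : Fin n) → 0 < c → c ≤ n → c ≤ s → s < c + n →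
    toℕ h ≡ s % n → roundTime n c s ∈ auxLabel n h
  roundTime⇒∈-auxLabel {c} {s} h 0<c c≤n c≤s s<c+n h≡s%n with m<n+n⇒m%n≡m⊎n+m%n≡m (<-≤-trans s<c+n (+-monoˡ-≤ n c≤n))
  ... | inj₁ s%n≡s = subst (λ x → roundTime n c x ∈ auxLabel n h) (trans h≡s%n s%n≡s)
          (∈-auxLabel⁺ h (≤-<-trans c≤s (subst (_< n) s%n≡s (m%n<n s n))) (inj₂ 0<c))
  roundTime⇒∈-auxLabel {suc k} {s} h _ k<n _ s<1+k+n h≡s%n | inj₂ n+s%n≡s =
    subst (_∈ auxLabel n h) (trans (roundTime-suc n k (toℕ h)) (cong (roundTime n (suc k)) n+h≡s))
      (∈-auxLabel⁺ h k<n (h≡0⊎0<k k s<1+k+n))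
    where
    n+h≡s : n + toℕ h ≡ s
    n+h≡s = trans (cong (λ x → n + x) h≡s%n) n+s%n≡s
    h≡0⊎0<k : ∀ k → s < suc k + n → toℕ h ≡ 0 ⊎ 0 < k
    h≡0⊎0<k zero    s<1+n = inj₁ (n≤0⇒n≡0 (+-cancelˡ-≤ n (toℕ h) 0
      (subst (_≤ n + 0) (sym n+h≡s) (subst (s ≤_) (sym (+-identityʳ n)) (s≤s⁻¹ s<1+n)))))
    h≡0⊎0<k (suc _) _ = inj₂ (s≤s z≤n)

  ∈-auxLabel⇒roundTime : ∀ {t s} (h : Fin n) → 0 < s → s < n + n → toℕ h ≡ s % n →
    t ∈ auxLabel n h → ∃[ c ] 0 < c × c ≤ n × t ≡ roundTime n c s
  ∈-auxLabel⇒roundTime {t} {s} h 0<s s<n+n h≡s%n t∈ with ∈-auxLabel⁻ h t∈ | m<n+n⇒m%n≡m⊎n+m%n≡m s<n+n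
  ... | k , k<n , h≡0⊎0<k , t≡ | inj₁ s%n≡s =
    k , 0<k h≡0⊎0<k , <⇒≤ k<n , trans t≡ (cong (roundTime n k) h≡s)
    where
    h≡s = trans h≡s%n s%n≡s
    0<k : toℕ h ≡ 0 ⊎ 0 < k → 0 < k
    0<k (inj₁ h≡0) = contradiction (trans (sym h≡s) h≡0) (>⇒≢ 0<s)
    0<k (inj₂ 0<k) = 0<k
  ... | k , k<n , _ , t≡ | inj₂ n+s%n≡s =
    suc k , s≤s z≤n , k<n ,
    trans t≡ (trans (roundTime-suc n k (toℕ h))
      (cong (roundTime n (suc k)) (trans (cong (λ x → n + x) h≡s%n) n+s%n≡s)))

  auxArc⇒≡suc% : ∀ {u v : Fin n} → auxArc n u v → toℕ v ≡ suc (toℕ u) % n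
  auxArc⇒≡suc% {u} (inj₁ 1+u≡v) = trans (sym 1+u≡v) (sym (m<n⇒m%n≡m (subst (_< n) (sym 1+u≡v) (toℕ<n _))))
  auxArc⇒≡suc% (inj₂ (1+u≡n , v≡0)) = trans v≡0 (sym (trans (cong (_% n) 1+u≡n) (n%n≡0 n)))

  ≡suc%⇒auxArc : ∀ {u v : Fin n} → toℕ v ≡ suc (toℕ u) % n → auxArc n u v
  ≡suc%⇒auxArc {u} v≡1+u%n with m≤n⇒m<n∨m≡n (toℕ<n u)
  ... | inj₁ 1+u<n  = inj₁ (sym (trans v≡1+u%n (m<n⇒m%n≡m 1+u<n)))
  ... | inj₂ 1+u≡n  = inj₂ (1+u≡n , trans v≡1+u%n (trans (cong (_% n) 1+u≡n) (n%n≡0 n)))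

  auxArc-chain-position : ∀ {q} (vs : Vec (Fin n) (suc q)) →
    (∀ j → auxArc n (lookup vs (inject₁ j)) (lookup vs (suc j))) →
    ∀ j → toℕ (lookup vs j) ≡ (toℕ j + toℕ (lookup vs zero)) % n
  auxArc-chain-position (u ∷ _) _ zero = sym (m<n⇒m%n≡m (toℕ<n u))
  auxArc-chain-position (u ∷ us@(_ ∷ _)) arcs (suc j) = begin
    toℕ (lookup us j)                   ≡⟨ auxArc-chain-position us (λ j → arcs (suc j)) j ⟩
    (toℕ j + toℕ (lookup us zero)) % n  ≡⟨ cong (λ x → (toℕ j + x) % n) (auxArc⇒≡suc% (arcs zero)) ⟩
    (toℕ j + suc (toℕ u) % n) % n       ≡⟨ [k+m%n]%n≡[k+m]%n (toℕ j) (suc (toℕ u)) ⟩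
    (toℕ j + suc (toℕ u)) % n           ≡⟨ cong (_% n) (+-suc (toℕ j) (toℕ u)) ⟩
    (suc (toℕ j) + toℕ u) % n           ∎
    where open ≡-Reasoning

module AuxiliaryCycle (m : ℕ) where

  n : ℕ
  n = suc m

  𝒜 : TemporalDigraph n
  𝒜 = auxiliaryCycle n

  rotate : Fin n → ℕ → Fin n
  rotate v k = (k + toℕ v) mod n

  toℕ-rotate : ∀ v k → toℕ (rotate v k) ≡ (k + toℕ v) % n
  toℕ-rotate v k = toℕ-fromℕ< _

  rotate-auxArc : ∀ v k → auxArc n (rotate v k) (rotate v (suc k))
  rotate-auxArc v k = ≡suc%⇒auxArc (begin
    toℕ (rotate v (suc k))       ≡⟨ toℕ-rotate v (suc k) ⟩
    suc (k + toℕ v) % n          ≡⟨ [k+m%n]%n≡[k+m]%n {n} 1 (k + toℕ v) ⟨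
    suc ((k + toℕ v) % n) % n    ≡⟨ cong (λ x → suc x % n) (toℕ-rotate v k) ⟨
    suc (toℕ (rotate v k)) % n   ∎)
    where open ≡-Reasoning

  rotate-zero : ∀ v → rotate v 0 ≡ v
  rotate-zero v = toℕ-injective (trans (toℕ-rotate v 0) (m<n⇒m%n≡m (toℕ<n v)))

  rotate-n : ∀ v → rotate v n ≡ v
  rotate-n v = toℕ-injective (begin
    toℕ (rotate v n)  ≡⟨ toℕ-rotate v n ⟩
    (n + toℕ v) % n   ≡⟨ cong (_% n) (+-comm n (toℕ v)) ⟩
    (toℕ v + n) % n   ≡⟨ [m+n]%n≡m%n (toℕ v) n ⟩
    toℕ v % n         ≡⟨ m<n⇒m%n≡m (toℕ<n v) ⟩
    toℕ v             ∎)
    where open ≡-Reasoning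

  rotate-injective : ∀ v {j k : Fin n} → rotate v (toℕ j) ≡ rotate v (toℕ k) → j ≡ k
  rotate-injective v {j} {k} rotate≡rotate = toℕ-injective (+-%-cancelʳ (toℕ v) (toℕ<n j) (toℕ<n k)
    (trans (sym (toℕ-rotate v (toℕ j))) (trans (cong toℕ rotate≡rotate) (toℕ-rotate v (toℕ k)))))

  cycleTime : Fin n → Fin n → ℤ
  cycleTime v j = + (suc (toℕ j) * m) -ℤ + toℕ v

  cycleTime≡roundTime : ∀ v j → cycleTime v j ≡ roundTime n (suc (toℕ j)) (suc (toℕ j) + toℕ v)
  cycleTime≡roundTime v j = trans (a-b≡[c+a]-[c+b] (+ (c * m)) (+ toℕ v) (+ c))
    (cong (λ x → + x -ℤ + (c + toℕ v)) (sym (*-suc c m)))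
    where c = suc (toℕ j)

  cyclePath : Fin n → Seq n
  cyclePath v = mkSeq n (tabulate (rotate v ∘ toℕ)) (tabulate (cycleTime v))

  src-cyclePath : ∀ v j → src (cyclePath v) j ≡ rotate v (toℕ j)
  src-cyclePath v j = trans (lookup∘tabulate (rotate v ∘ toℕ) (inject₁ j)) (cong (rotate v) (toℕ-inject₁ j))

  tgt-cyclePath : ∀ v j → tgt (cyclePath v) j ≡ rotate v (suc (toℕ j))
  tgt-cyclePath v j = lookup∘tabulate (rotate v ∘ toℕ) (suc j)

  tms-cyclePath : ∀ v j → lookup (tms (cyclePath v)) j ≡ cycleTime v j
  tms-cyclePath v j = lookup∘tabulate (cycleTime v) j

  cycleTime∈auxLabel : ∀ v j → cycleTime v j ∈ auxLabel n (rotate v (suc (toℕ j)))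
  cycleTime∈auxLabel v j = subst (_∈ auxLabel n (rotate v (suc (toℕ j)))) (sym (cycleTime≡roundTime v j))
    (roundTime⇒∈-auxLabel (rotate v (suc (toℕ j))) (s≤s z≤n) (toℕ<n j) (m≤m+n _ (toℕ v))
      (+-monoʳ-< (suc (toℕ j)) (toℕ<n v)) (toℕ-rotate v (suc (toℕ j))))

  cycleTime-mono : ∀ v {j k} → toℕ j ≤ toℕ k → cycleTime v j ≤ℤ cycleTime v k
  cycleTime-mono v j≤k = ℤ.+-monoˡ-≤ (- + toℕ v) (+≤+ (*-monoˡ-≤ m (s≤s j≤k)))

  cyclePath-isPath : ∀ v → IsTemporalVVPath 𝒜 v (cyclePath v)
  cyclePath-isPath v = record
    { walk = record
      { nonempty = s≤s z≤n
      ; arcs     = λ j → subst₂ (auxArc n) (sym (src-cyclePath v j)) (sym (tgt-cyclePath v j))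
                           (rotate-auxArc v (toℕ j))
      ; inLabel  = λ j → subst₂ _∈_ (sym (tms-cyclePath v j)) (cong (auxLabel n) (sym (tgt-cyclePath v j)))
                           (cycleTime∈auxLabel v j)
      ; nondecr  = λ j k j≤k → subst₂ _≤ℤ_ (sym (tms-cyclePath v j)) (sym (tms-cyclePath v k))
                           (cycleTime-mono v j≤k)
      }
    ; starts   = rotate-zero v
    ; ends     = trans (lookup∘tabulate (rotate v ∘ toℕ) (fromℕ n)) (trans (cong (rotate v) (toℕ-fromℕ n)) (rotate-n v))
    ; distinct = λ {j} {k} src≡src →
        rotate-injective v (trans (sym (src-cyclePath v j)) (trans src≡src (src-cyclePath v k)))
    }

  module _ {v : Fin n} {q} {vs : Vec (Fin n) (suc q)} {ts : Vec ℤ q}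
           (P : IsTemporalVVPath 𝒜 v (mkSeq q vs ts)) where
    open IsTemporalVVPath P
    open IsTemporalWalk walk

    path-position : ∀ j → toℕ (lookup vs j) ≡ (toℕ j + toℕ v) % n
    path-position j = subst (λ u → toℕ (lookup vs j) ≡ (toℕ j + toℕ u) % n) starts
      (auxArc-chain-position vs arcs j)

    path-length : q ≡ n
    path-length = [q+i]%n≡i⇒q≡n (toℕ<n v) nonempty (injective⇒≤ distinct) (begin
      (q + toℕ v) % n              ≡⟨ cong (λ k → (k + toℕ v) % n) (toℕ-fromℕ q) ⟨
      (toℕ (fromℕ q) + toℕ v) % n  ≡⟨ path-position (fromℕ q) ⟨
      toℕ (lookup vs (fromℕ q))    ≡⟨ cong toℕ ends ⟩
      toℕ v                        ∎)
      where open ≡-Reasoning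

  module _ {v : Fin n} {vs : Vec (Fin n) (suc n)} {ts : Vec ℤ n}
           (P : IsTemporalVVPath 𝒜 v (mkSeq n vs ts)) where
    open IsTemporalVVPath P
    open IsTemporalWalk walk

    path-verts : vs ≡ verts (cyclePath v)
    path-verts = lookup≗⇒≡tabulate λ j →
      toℕ-injective (trans (path-position P j) (sym (toℕ-rotate v (toℕ j))))

    path-round : ∀ j → ∃[ c ] 0 < c × c ≤ n × lookup ts j ≡ roundTime n c (suc (toℕ j) + toℕ v)
    path-round j = ∈-auxLabel⇒roundTime (lookup vs (suc j)) (s≤s z≤n) (+-mono-≤-< (toℕ<n j) (toℕ<n v))
      (path-position P (suc j)) (inLabel j)

    round : Fin n → ℕ
    round j = proj₁ (path-round j)

    round-time : ∀ j → lookup ts j ≡ roundTime n (round j) (suc (toℕ j) + toℕ v)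
    round-time j = proj₂ (proj₂ (proj₂ (path-round j)))

    round-increasing : ∀ {j k} → toℕ j < toℕ k → round j < round k
    round-increasing {j} {k} j<k = roundTime-≤⇒< n
      (subst₂ _≤ℤ_ (round-time j) (round-time k)
        (nondecr j k (<⇒≤ j<k)))
      (+-monoˡ-< (toℕ v) (s≤s j<k))

    path-tms : ts ≡ tms (cyclePath v)
    path-tms = lookup≗⇒≡tabulate λ j → begin
      lookup ts j                                         ≡⟨ round-time j ⟩
      roundTime n (round j) (suc (toℕ j) + toℕ v)         ≡⟨ cong (λ c → roundTime n c (suc (toℕ j) + toℕ v)) (round≡suc j) ⟩
      roundTime n (suc (toℕ j)) (suc (toℕ j) + toℕ v)     ≡⟨ cycleTime≡roundTime v j ⟨
      cycleTime v j                                       ∎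
      where
      open ≡-Reasoning
      round≡suc = strictlyIncreasing⇒≡suc round round-increasing
        (λ j → proj₁ (proj₂ (path-round j))) (λ j → proj₁ (proj₂ (proj₂ (path-round j))))

  cyclePath-unique : ∀ v (Q : Seq n) → IsTemporalVVPath 𝒜 v Q → Q ≡ cyclePath v
  cyclePath-unique v (mkSeq q vs ts) P with path-length P
  ... | refl = cong₂ (mkSeq n) (path-verts P) (path-tms P)

  cyclePaths-disjoint : ∀ {v w : Fin n} → v ≢ w → toℕ v ≢ m → toℕ w ≢ m →
    ¬ ShareTemporalArc (cyclePath v) (cyclePath w)
  cyclePaths-disjoint {v} {w} v≢w v≢m w≢m (j , k , _ , _ , same-time) =
    v≢w (toℕ-injective (sym (a*d+r≡b*d+s⇒r≡s {suc (toℕ j)} {suc (toℕ k)} m (<m w w≢m) (<m v v≢m)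
      (a-b≡c-d⇒a+d≡c+b (suc (toℕ j) * m) (toℕ v) (suc (toℕ k) * m) (toℕ w)
        (trans (sym (tms-cyclePath v j)) (trans same-time (tms-cyclePath w k)))))))
    where
    <m : ∀ u → toℕ u ≢ m → toℕ u < m
    <m u u≢m = ≤∧≢⇒< (s≤s⁻¹ (toℕ<n u)) u≢m

proposition3 : (n : ℕ) → 2 ≤ n →
    ((v : Fin n) → ∃[ P ] (IsTemporalVVPath (auxiliaryCycle n) v P
        × ((Q : Seq n) → IsTemporalVVPath (auxiliaryCycle n) v Q → Q ≡ P)))
    × ((i k : Fin n) → i ≢ k → toℕ i ≢ n ∸ 1 → toℕ k ≢ n ∸ 1 →
        (P Q : Seq n) → IsTemporalVVPath (auxiliaryCycle n) i P →
        IsTemporalVVPath (auxiliaryCycle n) k Q → ¬ ShareTemporalArc P Q)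
-- The argument only needs n ≥ 1.
proposition3 (suc m) _ =
  (λ v → cyclePath v , cyclePath-isPath v , cyclePath-unique v) ,
  λ i k i≢k i≢m k≢m P Q isP isQ →
    subst₂ (λ P Q → ¬ ShareTemporalArc P Q) (sym (cyclePath-unique i P isP)) (sym (cyclePath-unique k Q isQ))
      (cyclePaths-disjoint i≢k i≢m k≢m)
  where open AuxiliaryCycle m
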